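{- Let $Q$ be a finite set, $q\in Q$ and $s\in\mathrm{Stacks}(\Sigma)$. The map $g:d\mapsto\mathrm{LeftStack}(d)$ is an order isomorphism between $(\mathrm{dom}(\mathrm{Encode}(q,s))\setminus\{\varepsilon\},\le_{lex})$ and $(\mathrm{Milestones}(s),\le)$.
   Context: Collapsible pushdown stacks of level 2. Fix a finite alphabet $\Sigma$ containing $\bot$. A $2$-word over $\Gamma$ is a finite sequence $s=w_1:\dots:w_n$ of words over $\Gamma$. Stack letters are triples in $\Sigma\times\{1,2\}\times\mathbb N$. For $s=w_1:\dots:w_n$, $n\ge1$, $w_n=a_1\dots a_m$, $m\ge1$, $a_m=(\sigma,i,j)$: $\mathrm{Sym}(s)=\sigma$, $\mathrm{Lvl}(s)=i$, $\mathrm{Lnk}(s)=j$. Operations: $\mathrm{Pop}_2(s)=w_1:\dots:w_{n-1}$ if $n\ge2$; $\mathrm{Pop}_1(s)=w_1:\dots:w_{n-1}:a_1\dots a_{m-1}$ if $m\ge2$; $\mathrm{Clone}_2(s)=w_1:\dots:w_n:w_n$; for $\sigma\ne\bot$, $\mathrm{Push}_{\sigma,2}(s)=w_1:\dots:w_{n-1}:w_n(\sigma,2,n-1)$, $\mathrm{Push}_{\sigma,1}(s)=w_1:\dots:w_{n-1}:w_n(\sigma,1,m)$; $\mathrm{Collapse}(s)=w_1:\dots:w_r$ if $\mathrm{Lvl}(s)=2,\mathrm{Lnk}(s)=r>0$, $=\mathrm{Pop}_1(s)$ if $\mathrm{Lvl}(s)=1$; undefined otherwise. $\bot_2$ is the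 $2$-word consisting of the one-letter word $(\bot,1,0)$; $\mathrm{Stacks}(\Sigma)$ is the smallest set containing $\bot_2$ closed under these operations. Substacks: $s'\le s$ iff $s'=\mathrm{Pop}_1^{n_1}(\mathrm{Pop}_2^{n_2}(s))$. Milestones: for $s=w_1:\dots:w_n$, a substack $s'$ of $s$ is a milestone if $s'=w_1:\dots:w_i:w'$ with $0\le i<n$ and $w_i\sqcap w_{i+1}\le w'\le w_{i+1}$ (prefix order; $\sqcap$ = longest common prefix; $w_0:=\varepsilon$). $\mathrm{Milestones}(s)$ is ordered by $\le$. Trees: a $\Gamma$-labelled tree is a map $T:D\to\Gamma$ with $D\subseteq\{0,1\}^*$ finite nonempty prefix-closed. Lexicographic order: $d\le_{lex}d'$ iff $d$ is a prefix of $d'$, or $d=u0v$ and $d'=u1v'$ for some $u,v,v'$. Encoding. For a letter $a=(\sigma,l,k)$, an $a$-blockline is a $2$-word $s=w_1:\dots:w_n$, $n\ge1$, all of whose words start with $a$; write $w_i=a\,w_i'$, ${}_hs_i=w_h:\dots:w_i$, ${}_hs'_i=w'_h:\dots:w'_i$. Let $j=1$ if $|w_1|=1$; otherwise $j$ is the largest index such that $w_1,\dots,w_j$ all have length $\ge2$ and the same second letter $(\sigma',l',k')$. For $\rho\in(\Sigma\times\{1,2\})\cup\{\varepsilon\}$, $\mathrm{Encode}(s,\rho)$ is: the one-node tree $\rho$ if $|w_1|=1,n=1$; root $\rho$ with only right subtree $\mathrm{Encode}({}_2s_n,\varepsilon)$ if $|w_1|=1,n>1$; root $\rho$ with only left subtree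 $\mathrm{Encode}({}_1s'_n,(\sigma',l'))$ if $j=n,|w_1|>1$; otherwise root $\rho$ with left subtree $\mathrm{Encode}({}_1s'_j,(\sigma',l'))$ and right subtree $\mathrm{Encode}({}_{j+1}s_n,\varepsilon)$. For $s\in\mathrm{Stacks}(\Sigma)$, $\mathrm{Encode}(s)=\mathrm{Encode}(s,(\bot,1))$, and $\mathrm{Encode}(q,s)$ is the tree with root labelled $q$, left subtree $\mathrm{Encode}(s)$, no right subtree. The encoding is injective. Left stacks: for $d\in\mathrm{dom}(\mathrm{Encode}(q,s))\setminus\{\varepsilon\}$, the restriction of $\mathrm{Encode}(q,s)$ to $\{d'\in\mathrm{dom}(\mathrm{Encode}(q,s)): d'\le_{lex}d\}$ is the encoding $\mathrm{Encode}(q,s_d)$ of a configuration $(q,s_d)$; set $\mathrm{LeftStack}(d):=s_d$. -}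

module Defs where

open import Data.Nat using (ℕ; zero; suc; _<_)
import Data.Nat as ℕ
open import Data.Fin using (Fin) renaming (zero to fzero)
import Data.Fin as F
open import Data.List using (List; []; _∷_; _++_; _∷ʳ_; length; take; map)
open import Data.Nat.ListAction using (sum)
open import Data.Maybe using (Maybe; just; nothing; _>>=_)
open import Data.Product using (Σ; ∃; ∃₂; _×_; _,_; proj₁; proj₂)
open import Data.Product.Properties using (≡-dec)
open import Data.Sum using (_⊎_)
open import Data.Bool using (Bool; true; false)
open import Relation.Binary.PropositionalEquality using (_≡_; _≢_; refl)
open import Relation.Binary.Definitions using (DecidableEquality)
open import Relation.Nullary using (¬_; yes; no)
open import Function.Bundles using (_⇔_)

data Lvl : Set where
  one two : Lvl

_≟L_ : DecidableEquality Lvl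
one ≟L one = yes refl
one ≟L two = no λ ()
two ≟L one = no λ ()
two ≟L two = yes refl

Sym : ℕ → Set
Sym k = Fin (suc k)

⊥s : ∀ {k} → Sym k
⊥s = fzero

-- stack letters (σ , level , link)
Letter : ℕ → Set
Letter k = Sym k × Lvl × ℕ

_≟a_ : ∀ {k} → DecidableEquality (Letter k)
_≟a_ = ≡-dec F._≟_ (≡-dec _≟L_ ℕ._≟_)

Word : ℕ → Set
Word k = List (Letter k)

-- 2-word w₁ : … : wₙ, represented as the list (w₁ ∷ … ∷ wₙ ∷ [])
Stack2 : ℕ → Set
Stack2 k = List (Word k)

splitLast : ∀ {A : Set} → List A → Maybe (List A × A)
splitLast [] = nothing
splitLast (x ∷ []) = just ([] , x)
splitLast (x ∷ y ∷ xs) with splitLast (y ∷ xs)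
... | nothing = nothing
... | just (ys , z) = just (x ∷ ys , z)

⊥₂ : ∀ {k} → Stack2 k
⊥₂ = ((⊥s , one , 0) ∷ []) ∷ []

pop2 : ∀ {k} → Stack2 k → Maybe (Stack2 k)
pop2 s with splitLast s
... | nothing = nothing
... | just ([] , _) = nothing
... | just (ws@(_ ∷ _) , _) = just ws

pop1 : ∀ {k} → Stack2 k → Maybe (Stack2 k)
pop1 s with splitLast s
... | nothing = nothing
... | just (ws , w) with splitLast w
...   | nothing = nothing
...   | just ([] , _) = nothing
...   | just (u@(_ ∷ _) , _) = just (ws ∷ʳ u)

clone2 : ∀ {k} → Stack2 k → Maybe (Stack2 k)
clone2 s with splitLast s
... | nothing = nothing
... | just (ws , w) = just (ws ∷ʳ w ∷ʳ w)

-- Push_{σ,l}; the side condition σ ≠ ⊥ is imposed in `Stacks` below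
push : ∀ {k} → Sym k → Lvl → Stack2 k → Maybe (Stack2 k)
push σ two s with splitLast s
... | nothing = nothing
... | just (ws , w) = just (ws ∷ʳ (w ∷ʳ (σ , two , length ws)))
push σ one s with splitLast s
... | nothing = nothing
... | just (ws , w) = just (ws ∷ʳ (w ∷ʳ (σ , one , length w)))

collapse : ∀ {k} → Stack2 k → Maybe (Stack2 k)
collapse s with splitLast s
... | nothing = nothing
... | just (ws , w) with splitLast w
...   | nothing = nothing
...   | just (_ , (σ , one , j)) = pop1 s
...   | just (_ , (σ , two , zero)) = nothing
...   | just (_ , (σ , two , suc r)) = just (take (suc r) s)

data Stacks {k : ℕ} : Stack2 k → Set where
  base      : Stacks ⊥₂
  viaPop2   : ∀ {s t} → Stacks s → pop2 s ≡ just t → Stacks t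
  viaPop1   : ∀ {s t} → Stacks s → pop1 s ≡ just t → Stacks t
  viaClone2 : ∀ {s t} → Stacks s → clone2 s ≡ just t → Stacks t
  viaPush   : ∀ {s t} (σ : Sym k) (l : Lvl) → σ ≢ ⊥s → Stacks s →
              push σ l s ≡ just t → Stacks t
  viaCollapse : ∀ {s t} → Stacks s → collapse s ≡ just t → Stacks t

iterM : ∀ {A : Set} → ℕ → (A → Maybe A) → A → Maybe A
iterM zero f a = just a
iterM (suc n) f a = f a >>= iterM n f

_≼_ : ∀ {k} → Stack2 k → Stack2 k → Set
s' ≼ s = ∃₂ λ n₁ n₂ → (iterM n₂ pop2 s >>= iterM n₁ pop1) ≡ just s'

_⊑_ : ∀ {A : Set} → List A → List A → Set
u ⊑ v = ∃ λ e → u ++ e ≡ v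

_⊓_ : ∀ {k} → Word k → Word k → Word k
[] ⊓ _ = []
(_ ∷ _) ⊓ [] = []
(x ∷ xs) ⊓ (y ∷ ys) with x ≟a y
... | yes _ = x ∷ (xs ⊓ ys)
... | no _ = []

nth : ∀ {A : Set} → List (List A) → ℕ → List A
nth [] _ = []
nth (x ∷ _) zero = x
nth (_ ∷ xs) (suc i) = nth xs i

-- W s j = w_j (1-indexed), with W s 0 = w₀ = ε
W : ∀ {k} → Stack2 k → ℕ → Word k
W s zero = []
W s (suc j) = nth s j

IsMilestone : ∀ {k} → Stack2 k → Stack2 k → Set
IsMilestone s s' =
  s' ≼ s ×
  ∃ λ i → i < length s × ∃ λ w' →
    s' ≡ take i s ++ (w' ∷ []) × ((W s i ⊓ W s (suc i)) ⊑ w') × (w' ⊑ W s (suc i))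

-- Binary trees with optional children; addresses in {0,1}* (false = 0, true = 1)

data Tree (Γ : Set) : Set where
  node : Γ → Maybe (Tree Γ) → Maybe (Tree Γ) → Tree Γ

Address : Set
Address = List Bool

lookupT : ∀ {Γ : Set} → Tree Γ → Address → Maybe Γ
lookupT (node x _ _) [] = just x
lookupT (node _ nothing _) (false ∷ d) = nothing
lookupT (node _ (just l) _) (false ∷ d) = lookupT l d
lookupT (node _ _ nothing) (true ∷ d) = nothing
lookupT (node _ _ (just r)) (true ∷ d) = lookupT r d

_∈dom_ : ∀ {Γ : Set} → Address → Tree Γ → Set
d ∈dom T = ∃ λ x → lookupT T d ≡ just x

_≤lex_ : Address → Address → Set
d ≤lex d' = d ⊑ d' ⊎ ∃₂ λ u v → ∃ λ v' → d ≡ u ++ false ∷ v × d' ≡ u ++ true ∷ v'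

IsRestrictionLex : ∀ {Γ : Set} → Tree Γ → Address → Tree Γ → Set
IsRestrictionLex T d T' =
  ∀ d' → (d' ≤lex d → lookupT T' d' ≡ lookupT T d') × (¬ (d' ≤lex d) → lookupT T' d' ≡ nothing)

data Label (Q : Set) (k : ℕ) : Set where
  st  : Q → Label Q k
  sy  : Sym k → Lvl → Label Q k
  eps : Label Q k

takeB : ∀ {k} → Letter k → List (Word k) → List (Word k) × List (Word k)
takeB b [] = [] , []
takeB b ([] ∷ ws) = [] , [] ∷ ws
takeB b ((x ∷ []) ∷ ws) = [] , (x ∷ []) ∷ ws
takeB b ((x ∷ y ∷ w) ∷ ws) with y ≟a b
... | no _ = [] , (x ∷ y ∷ w) ∷ ws
... | yes _ with takeB b ws
...   | (p , r) = ((x ∷ y ∷ w) ∷ p) , r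

tail : ∀ {A : Set} → List A → List A
tail [] = []
tail (_ ∷ xs) = xs

leaf : ∀ {Γ : Set} → Γ → Tree Γ
leaf x = node x nothing nothing

-- Encode(s, ρ), by recursion on a fuel argument (the number of letters of s
-- strictly decreases at every recursive call, so fuel = size s suffices)
enc : ∀ {Q : Set} {k} → ℕ → Label Q k → List (Word k) → Tree (Label Q k)
enc zero ρ _ = leaf ρ
enc (suc f) ρ [] = leaf ρ
enc (suc f) ρ ([] ∷ _) = leaf ρ
enc (suc f) ρ ((a ∷ []) ∷ []) = leaf ρ
enc (suc f) ρ ((a ∷ []) ∷ w ∷ ws) = node ρ nothing (just (enc f eps (w ∷ ws)))
enc (suc f) ρ ((a ∷ b ∷ w) ∷ ws) with takeB b ws
... | (p , []) =
      node ρ (just (enc f (sy (proj₁ b) (proj₁ (proj₂ b))) ((b ∷ w) ∷ map tail p))) nothing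
... | (p , r@(_ ∷ _)) =
      node ρ (just (enc f (sy (proj₁ b) (proj₁ (proj₂ b))) ((b ∷ w) ∷ map tail p)))
             (just (enc f eps r))

size : ∀ {k} → Stack2 k → ℕ
size s = sum (map length s)

Encode : ∀ {Q : Set} {k} → Stack2 k → Tree (Label Q k)
Encode s = enc (size s) (sy ⊥s one) s

EncodeConf : ∀ {Q : Set} {k} → Q → Stack2 k → Tree (Label Q k)
EncodeConf q s = node (st q) (just (Encode s)) nothing

Dom : ∀ {Q : Set} {k} → Q → Stack2 k → Set
Dom q s = Σ Address λ d → (d ∈dom EncodeConf q s) × d ≢ []

-- t = LeftStack(d): t ∈ Stacks(Σ) and Encode(q,t) is the restriction of
-- Encode(q,s) to {d' : d' ≤lex d}  (t is unique by injectivity of Encode)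
IsLeftStack : ∀ {Q : Set} {k} → Q → Stack2 k → Address → Stack2 k → Set
IsLeftStack q s d t = Stacks t × IsRestrictionLex (EncodeConf q s) d (EncodeConf q t)

IsOrderIsoMilestones : ∀ {Q : Set} {k} (q : Q) (s : Stack2 k) → (Dom q s → Stack2 k) → Set
IsOrderIsoMilestones q s g =
  (∀ x → IsMilestone s (g x)) ×
  (∀ x y → g x ≡ g y → proj₁ x ≡ proj₁ y) ×
  (∀ t → IsMilestone s t → ∃ λ x → g x ≡ t) ×
  (∀ x y → (proj₁ x ≤lex proj₁ y) ⇔ (g x ≼ g y))

-- Encode(s) is built by recursion on the blockline s: a node splits the words of s into the maximal
-- leading block of words sharing their second letter (left subtree, first letter stripped) and the
-- remaining words (right subtree). The left stack of the node at address d is computed by the same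
-- recursion along d: a left step keeps only the block, a right step keeps the whole block and goes on
-- in the rest. Induction along d shows that its encoding is the restriction of Encode(s) to the nodes
-- ≤lex d, and that it is a milestone: a right step cuts where two consecutive words part right after
-- their common first letter, which is exactly the milestone condition w_i ⊓ w_{i+1} ⊑ w'. Larger
-- addresses give longer cuts, so the map is monotone, and since it is injective, the substack order
-- is antisymmetric and ≤lex is total, it also reflects the order. Conversely a milestone is reached by
-- following the block structure down to the word that contains its top word.

module Submission where

open import Defs
open import Data.Nat using (ℕ; zero; suc; _+_; _≤_; _<_; _<?_; z≤n; s≤s; s≤s⁻¹; z<s)
open import Data.Nat.Properties
open import Data.Nat.ListAction using (sum)
open import Data.Nat.ListAction.Properties using (sum-++)
open import Data.Fin using (Fin)
open import Data.Product using (Σ; ∃; _×_; _,_; proj₁; proj₂)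
open import Data.Sum as Sum using (_⊎_; inj₁; inj₂)
open import Data.List using (List; []; _∷_; _++_; _∷ʳ_; length; take; drop; map; initLast; _∷ʳ′_)
open import Data.List.Properties
  using (++-assoc; ++-identityʳ; ++-cancelˡ; ∷-injectiveʳ; length-++; length-map; map-++; map-∘; map-id; map-id-local;
         map-injective; take-map; take++drop≡id)
open import Data.List.Relation.Unary.All as All using (All; []; _∷_)
open import Data.List.Relation.Unary.All.Properties using (∷ʳ⁺; ∷ʳ⁻; take⁺; ++⁺; ++⁻ʳ; map⁺)
open import Data.Maybe using (Maybe; just; nothing; _>>=_)
open import Data.Maybe.Properties using (just-injective)
open import Data.Empty using (⊥-elim)
open import Data.Unit using (⊤; tt)
open import Data.Bool using (true; false)
open import Relation.Binary.PropositionalEquality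
open import Relation.Nullary using (¬_; yes; no)
open import Function.Bundles using (_⇔_; mk⇔)

splitLast-∷ʳ : ∀ {A : Set} (xs : List A) y → splitLast (xs ∷ʳ y) ≡ just (xs , y)
splitLast-∷ʳ [] y = refl
splitLast-∷ʳ (x ∷ []) y = refl
splitLast-∷ʳ (x ∷ x' ∷ xs) y rewrite splitLast-∷ʳ (x' ∷ xs) y = refl

∷ʳ≢[] : ∀ {A : Set} (xs : List A) x → xs ∷ʳ x ≢ []
∷ʳ≢[] [] x ()
∷ʳ≢[] (_ ∷ _) x ()

nth-++ˡ : ∀ {A : Set} (B R : List (List A)) {i} → i < length B → nth (B ++ R) i ≡ nth B i
nth-++ˡ (x ∷ B) R {zero} _ = refl
nth-++ˡ (x ∷ B) R {suc i} i<B = nth-++ˡ B R (s≤s⁻¹ i<B)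

nth-++ʳ : ∀ {A : Set} (B R : List (List A)) i → nth (B ++ R) (length B + i) ≡ nth R i
nth-++ʳ [] R i = refl
nth-++ʳ (x ∷ B) R i = nth-++ʳ B R i

nth-map : ∀ {A : Set} (f : List A → List A) L {i} → i < length L → nth (map f L) i ≡ f (nth L i)
nth-map f (x ∷ L) {zero} _ = refl
nth-map f (x ∷ L) {suc i} i<L = nth-map f L (s≤s⁻¹ i<L)

nth-All : ∀ {A : Set} {P : List A → Set} {L} i → All P L → i < length L → P (nth L i)
nth-All zero (px ∷ _) _ = px
nth-All (suc i) (_ ∷ pL) i<L = nth-All i pL (s≤s⁻¹ i<L)

take-suc-nth : ∀ {A : Set} (L : List (List A)) {i} → i < length L → take (suc i) L ≡ take i L ∷ʳ nth L i
take-suc-nth (x ∷ L) {zero} _ = refl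
take-suc-nth (x ∷ L) {suc i} i<L = cong (x ∷_) (take-suc-nth L (s≤s⁻¹ i<L))

take-++ˡ : ∀ {A : Set} (B R : List A) {i} → i ≤ length B → take i (B ++ R) ≡ take i B
take-++ˡ B R {zero} _ = refl
take-++ˡ (x ∷ B) R {suc i} i≤B = cong (x ∷_) (take-++ˡ B R (s≤s⁻¹ i≤B))

take-++ʳ : ∀ {A : Set} (B R : List A) i → take (length B + i) (B ++ R) ≡ B ++ take i R
take-++ʳ [] R i = refl
take-++ʳ (x ∷ B) R i = cong (x ∷_) (take-++ʳ B R i)

length-take-≤ : ∀ {A : Set} (L : List A) {i} → i ≤ length L → length (take i L) ≡ i
length-take-≤ L {zero} _ = refl
length-take-≤ (x ∷ L) {suc i} i≤L = cong suc (length-take-≤ L (s≤s⁻¹ i≤L))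

[]⊑ : ∀ {A : Set} (u : List A) → [] ⊑ u
[]⊑ u = u , refl

∷-⊑ : ∀ {A : Set} (a : A) {x y} → x ⊑ y → (a ∷ x) ⊑ (a ∷ y)
∷-⊑ a (e , x++e≡y) = e , cong (a ∷_) x++e≡y

∷-⊑⁻ : ∀ {A : Set} {a : A} {x y} → (a ∷ x) ⊑ (a ∷ y) → x ⊑ y
∷-⊑⁻ (e , refl) = e , refl

⊑-∷ʳ : ∀ {A : Set} {a : A} {v u} → (a ∷ v) ⊑ u → ∃ λ u' → u ≡ a ∷ u' × v ⊑ u'
⊑-∷ʳ (e , refl) = _ , refl , e , refl

⊑∷-nonempty : ∀ {A : Set} {a : A} {u x} → u ⊑ (a ∷ x) → u ≢ [] → ∃ λ u' → u ≡ a ∷ u'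
⊑∷-nonempty {u = []} _ u≢[] = ⊥-elim (u≢[] refl)
⊑∷-nonempty {u = c ∷ u'} (e , refl) _ = u' , refl

⊓-∷ : ∀ {k} (a : Letter k) x y → (a ∷ x) ⊓ (a ∷ y) ≡ a ∷ (x ⊓ y)
⊓-∷ a x y with a ≟a a
... | yes _ = refl
... | no a≢a = ⊥-elim (a≢a refl)

pop2-∷ʳ : ∀ {k} (x : Word k) xs y → pop2 ((x ∷ xs) ∷ʳ y) ≡ just (x ∷ xs)
pop2-∷ʳ x xs y rewrite splitLast-∷ʳ (x ∷ xs) y = refl

pop1-∷ʳ : ∀ {k} (ws : Stack2 k) c u x → pop1 (ws ∷ʳ ((c ∷ u) ∷ʳ x)) ≡ just (ws ∷ʳ (c ∷ u))
pop1-∷ʳ ws c u x rewrite splitLast-∷ʳ ws ((c ∷ u) ∷ʳ x) | splitLast-∷ʳ (c ∷ u) x = refl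

pop2⁻ : ∀ {k} (s t : Stack2 k) → pop2 s ≡ just t → t ≢ [] × ∃ λ w → s ≡ t ∷ʳ w
pop2⁻ s t eq with initLast s
pop2⁻ .[] t () | []
pop2⁻ .(ws ∷ʳ w) t eq | ws ∷ʳ′ w rewrite splitLast-∷ʳ ws w with ws | eq
... | _ ∷ _ | refl = (λ ()) , w , refl

DropsTopLetter : ∀ {k} → Stack2 k → Stack2 k → Set
DropsTopLetter s t =
  ∃ λ ws → ∃ λ c → ∃ λ u → ∃ λ x → s ≡ ws ∷ʳ ((c ∷ u) ∷ʳ x) × t ≡ ws ∷ʳ (c ∷ u)

pop1⁻ : ∀ {k} (s t : Stack2 k) → pop1 s ≡ just t → DropsTopLetter s t
pop1⁻ s t eq with initLast s
pop1⁻ .[] t () | []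
pop1⁻ .(ws ∷ʳ w) t eq | ws ∷ʳ′ w rewrite splitLast-∷ʳ ws w with initLast w
pop1⁻ .(ws ∷ʳ []) t () | ws ∷ʳ′ .[] | []
pop1⁻ .(ws ∷ʳ (u ∷ʳ x)) t eq | ws ∷ʳ′ .(u ∷ʳ x) | u ∷ʳ′ x rewrite splitLast-∷ʳ u x with u | eq
... | c ∷ u' | refl = ws , c , u' , x , refl , refl

clone2⁻ : ∀ {k} (s t : Stack2 k) → clone2 s ≡ just t →
  ∃ λ ws → ∃ λ w → s ≡ ws ∷ʳ w × t ≡ ws ∷ʳ w ∷ʳ w
clone2⁻ s t eq with initLast s
clone2⁻ .[] t () | []
clone2⁻ .(ws ∷ʳ w) t eq | ws ∷ʳ′ w rewrite splitLast-∷ʳ ws w with eq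
... | refl = ws , w , refl , refl

push⁻ : ∀ {k} σ l (s t : Stack2 k) → push σ l s ≡ just t →
  ∃ λ ws → ∃ λ w → ∃ λ x → s ≡ ws ∷ʳ w × t ≡ ws ∷ʳ (w ∷ʳ x)
push⁻ σ l s t eq with initLast s
push⁻ σ one .[] t () | []
push⁻ σ two .[] t () | []
push⁻ σ one .(ws ∷ʳ w) t eq | ws ∷ʳ′ w rewrite splitLast-∷ʳ ws w with eq
... | refl = ws , w , _ , refl , refl
push⁻ σ two .(ws ∷ʳ w) t eq | ws ∷ʳ′ w rewrite splitLast-∷ʳ ws w with eq
... | refl = ws , w , _ , refl , refl

collapse⁻ : ∀ {k} (s t : Stack2 k) → collapse s ≡ just t → DropsTopLetter s t ⊎ ∃ λ r → t ≡ take (suc r) s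
collapse⁻ s t eq with initLast s
collapse⁻ .[] t () | []
collapse⁻ .(ws ∷ʳ w) t eq | ws ∷ʳ′ w rewrite splitLast-∷ʳ ws w with initLast w
collapse⁻ .(ws ∷ʳ []) t () | ws ∷ʳ′ .[] | []
collapse⁻ .(ws ∷ʳ (u ∷ʳ (σ , one , j))) t eq | ws ∷ʳ′ .(u ∷ʳ (σ , one , j)) | u ∷ʳ′ (σ , one , j)
  rewrite splitLast-∷ʳ u (σ , one , j) = inj₁ (pop1⁻ _ t eq)
collapse⁻ .(ws ∷ʳ (u ∷ʳ (σ , two , zero))) t eq | ws ∷ʳ′ .(u ∷ʳ (σ , two , zero)) | u ∷ʳ′ (σ , two , zero)
  rewrite splitLast-∷ʳ u (σ , two , zero) with eq
... | ()
collapse⁻ .(ws ∷ʳ (u ∷ʳ (σ , two , suc r))) t eq | ws ∷ʳ′ .(u ∷ʳ (σ , two , suc r)) | u ∷ʳ′ (σ , two , suc r)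
  rewrite splitLast-∷ʳ u (σ , two , suc r) = inj₂ (r , sym (just-injective eq))

StartsWith : ∀ {k} → Letter k → Word k → Set
StartsWith a w = ∃ λ w' → w ≡ a ∷ w'

bottomLetter : ∀ {k} → Letter k
bottomLetter = (⊥s , one , 0)

WellFormed : ∀ {k} → Stack2 k → Set
WellFormed s = s ≢ [] × All (StartsWith bottomLetter) s

All-DropsTopLetter : ∀ {k} {a : Letter k} {s t} → DropsTopLetter s t → All (StartsWith a) s → All (StartsWith a) t
All-DropsTopLetter (ws , c , u , x , refl , refl) as with ∷ʳ⁻ as
... | aws , (_ , refl) = ∷ʳ⁺ aws (u , refl)

stacks-wellFormed : ∀ {k} {s : Stack2 k} → Stacks s → WellFormed s
stacks-wellFormed base = (λ ()) , (_ , refl) ∷ []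
stacks-wellFormed (viaPop2 {s} {t} hs eq) with pop2⁻ s t eq | stacks-wellFormed hs
... | t≢[] , w , refl | _ , as = t≢[] , proj₁ (∷ʳ⁻ as)
stacks-wellFormed (viaPop1 {s} {t} hs eq) with stacks-wellFormed hs
... | _ , as with pop1⁻ s t eq
... | popped@(ws , _ , _ , _ , _ , refl) = ∷ʳ≢[] ws _ , All-DropsTopLetter popped as
stacks-wellFormed (viaClone2 {s} {t} hs eq) with clone2⁻ s t eq | stacks-wellFormed hs
... | ws , w , refl , refl | _ , as = ∷ʳ≢[] _ w , ∷ʳ⁺ as (proj₂ (∷ʳ⁻ as))
stacks-wellFormed (viaPush {s} {t} σ l _ hs eq) with push⁻ σ l s t eq | stacks-wellFormed hs
... | ws , w , x , refl , refl | _ , as with ∷ʳ⁻ as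
... | aws , (w' , refl) = ∷ʳ≢[] ws _ , ∷ʳ⁺ aws (w' ∷ʳ x , refl)
stacks-wellFormed (viaCollapse {s} {t} hs eq) with stacks-wellFormed hs | collapse⁻ s t eq
... | _ , as | inj₁ popped@(ws , _ , _ , _ , _ , refl) = ∷ʳ≢[] ws _ , All-DropsTopLetter popped as
... | s≢[] , as | inj₂ (r , refl) = take-suc≢[] s s≢[] , take⁺ (suc r) as
  where
  take-suc≢[] : ∀ s → s ≢ [] → take (suc r) s ≢ []
  take-suc≢[] [] s≢[] = s≢[]
  take-suc≢[] (_ ∷ _) _ ()

iterM-suc : ∀ {A : Set} n (f : A → Maybe A) a → iterM (suc n) f a ≡ (iterM n f a >>= f)
iterM-suc zero f a with f a
... | nothing = refl
... | just b = refl
iterM-suc (suc n) f a with f a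
... | nothing = refl
... | just b = iterM-suc n f b

iterM-preserves : ∀ {A : Set} (P : A → Set) {f : A → Maybe A} → (∀ {a b} → P a → f a ≡ just b → P b) →
  ∀ n {a b} → P a → iterM n f a ≡ just b → P b
iterM-preserves P step zero pa refl = pa
iterM-preserves P {f} step (suc n) {a} pa eq with f a in fa≡b
... | just b = iterM-preserves P step n (step pa fa≡b) eq

≼-preserves : ∀ {k} (P : Stack2 k → Set) →
  (∀ {a b} → P a → pop1 a ≡ just b → P b) → (∀ {a b} → P a → pop2 a ≡ just b → P b) →
  ∀ {s t} → P s → t ≼ s → P t
≼-preserves P step₁ step₂ {s} ps (n₁ , n₂ , eq) with iterM n₂ pop2 s in pops₂
... | just s' = iterM-preserves P step₁ n₁ (iterM-preserves P step₂ n₂ ps pops₂) eq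

stacks-≼ : ∀ {k} {s t : Stack2 k} → Stacks s → t ≼ s → Stacks t
stacks-≼ = ≼-preserves Stacks viaPop1 viaPop2

weight : ∀ {k} → Stack2 k → ℕ
weight s = sum (map (λ w → suc (length w)) s)

weight-++ : ∀ {k} (xs ys : Stack2 k) → weight (xs ++ ys) ≡ weight xs + weight ys
weight-++ xs ys rewrite map-++ (λ w → suc (length w)) xs ys = sum-++ (map _ xs) _

weight-∷ʳ : ∀ {k} (xs : Stack2 k) w → weight (xs ∷ʳ w) ≡ weight xs + suc (length w + 0)
weight-∷ʳ xs w = weight-++ xs (w ∷ [])

pop2-weight : ∀ {k} (a b : Stack2 k) → pop2 a ≡ just b → weight b < weight a
pop2-weight a b eq with pop2⁻ a b eq
... | _ , w , refl rewrite weight-∷ʳ b w = m<m+n (weight b) z<s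

pop1-weight : ∀ {k} (a b : Stack2 k) → pop1 a ≡ just b → weight b < weight a
pop1-weight a b eq with pop1⁻ a b eq
... | ws , c , u , x , refl , refl
  rewrite weight-∷ʳ ws ((c ∷ u) ∷ʳ x) | weight-∷ʳ ws (c ∷ u) | length-++ u {x ∷ []} | +-comm (length u) 1 =
  +-monoʳ-< (weight ws) (n<1+n _)

≼-shrinks : ∀ {k} {s t : Stack2 k} → t ≼ s → t ≡ s ⊎ weight t < weight s
≼-shrinks {s = s} =
  ≼-preserves (λ t → t ≡ s ⊎ weight t < weight s) (below pop1 pop1-weight) (below pop2 pop2-weight) (inj₁ refl)
  where
  below : ∀ (op : Stack2 _ → Maybe (Stack2 _)) → (∀ a b → op a ≡ just b → weight b < weight a) →
    ∀ {a b} → a ≡ s ⊎ weight a < weight s → op a ≡ just b → b ≡ s ⊎ weight b < weight s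
  below _ shrink (inj₁ refl) eq = inj₂ (shrink _ _ eq)
  below _ shrink (inj₂ a<s) eq = inj₂ (<-trans (shrink _ _ eq) a<s)

≼-antisym : ∀ {k} {s t : Stack2 k} → t ≼ s → s ≼ t → t ≡ s
≼-antisym t≼s s≼t with ≼-shrinks t≼s | ≼-shrinks s≼t
... | inj₁ t≡s | _ = t≡s
... | inj₂ _ | inj₁ s≡t = sym s≡t
... | inj₂ t<s | inj₂ s<t = ⊥-elim (<-asym t<s s<t)

PrefixCut : ∀ {k} → Stack2 k → Stack2 k → Set
PrefixCut L t = ∃ λ i → ∃ λ u → i < length L × t ≡ take i L ++ u ∷ [] × u ≢ [] × u ⊑ nth L i

iterM-pop2 : ∀ {k} (x : Word k) xs e → iterM (length e) pop2 ((x ∷ xs) ++ e) ≡ just (x ∷ xs)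
iterM-pop2 x xs [] rewrite ++-identityʳ xs = refl
iterM-pop2 x xs (y ∷ e) rewrite sym (++-assoc (x ∷ xs) (y ∷ []) e)
  | iterM-suc (length e) pop2 (((x ∷ xs) ∷ʳ y) ++ e) | iterM-pop2 x (xs ∷ʳ y) e = pop2-∷ʳ x xs y

iterM-pop2-∷ʳ : ∀ {k} (ws : Stack2 k) w e → iterM (length e) pop2 ((ws ∷ʳ w) ++ e) ≡ just (ws ∷ʳ w)
iterM-pop2-∷ʳ [] w e = iterM-pop2 w [] e
iterM-pop2-∷ʳ (v ∷ ws) w e = iterM-pop2 v (ws ∷ʳ w) e

iterM-pop1 : ∀ {k} (ws : Stack2 k) c u e → iterM (length e) pop1 (ws ∷ʳ ((c ∷ u) ++ e)) ≡ just (ws ∷ʳ (c ∷ u))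
iterM-pop1 ws c u [] rewrite ++-identityʳ u = refl
iterM-pop1 ws c u (y ∷ e) rewrite sym (++-assoc (c ∷ u) (y ∷ []) e)
  | iterM-suc (length e) pop1 (ws ∷ʳ (((c ∷ u) ∷ʳ y) ++ e)) | iterM-pop1 ws c (u ∷ʳ y) e = pop1-∷ʳ ws c u y

-- pop₂ the words above position i, then pop₁ the letters of its word beyond u
prefixCut⇒≼ : ∀ {k} {L t : Stack2 k} → PrefixCut L t → t ≼ L
prefixCut⇒≼ (i , [] , _ , _ , u≢[] , _) = ⊥-elim (u≢[] refl)
prefixCut⇒≼ {L = L} (i , c ∷ u , i<L , refl , _ , e , u++e≡Lᵢ) =
  length e , length above , subst (λ z → (iterM (length above) pop2 z >>= iterM (length e) pop1) ≡ just cut) L≡ pops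
  where
  above = drop (suc i) L
  cut = take i L ∷ʳ (c ∷ u)
  L≡ : (take i L ∷ʳ ((c ∷ u) ++ e)) ++ above ≡ L
  L≡ = begin
    (take i L ∷ʳ ((c ∷ u) ++ e)) ++ above ≡⟨ cong (λ z → (take i L ∷ʳ z) ++ above) u++e≡Lᵢ ⟩
    (take i L ∷ʳ nth L i) ++ above         ≡⟨ cong (_++ above) (take-suc-nth L i<L) ⟨
    take (suc i) L ++ above               ≡⟨ take++drop≡id (suc i) L ⟩
    L                                     ∎
    where open ≡-Reasoning
  pops : (iterM (length above) pop2 ((take i L ∷ʳ ((c ∷ u) ++ e)) ++ above) >>= iterM (length e) pop1) ≡ just cut
  pops rewrite iterM-pop2-∷ʳ (take i L) ((c ∷ u) ++ e) above = iterM-pop1 (take i L) c u e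

StartsWith₂ : ∀ {k} → Letter k → Letter k → Word k → Set
StartsWith₂ a b w = ∃ λ v → w ≡ a ∷ b ∷ v

data Breaks {k} (b : Letter k) : Word k → Set where
  breaks-[]  : Breaks b []
  breaks-[_] : ∀ x → Breaks b (x ∷ [])
  breaks-≢   : ∀ {x y w} → y ≢ b → Breaks b (x ∷ y ∷ w)

BlockEnds : ∀ {k} → Letter k → List (Word k) → Set
BlockEnds b [] = ⊤
BlockEnds b (w ∷ _) = Breaks b w

block rest : ∀ {k} → Letter k → List (Word k) → List (Word k)
block b ws = proj₁ (takeB b ws)
rest b ws = proj₂ (takeB b ws)

takeB-split : ∀ {k} (b : Letter k) ws → ws ≡ block b ws ++ rest b ws
takeB-split b [] = refl
takeB-split b ([] ∷ ws) = refl
takeB-split b ((x ∷ []) ∷ ws) = refl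
takeB-split b ((x ∷ y ∷ w) ∷ ws) with y ≟a b
... | no _ = refl
... | yes _ = cong (_ ∷_) (takeB-split b ws)

takeB-block : ∀ {k} {a : Letter k} b {ws} → All (StartsWith a) ws → All (StartsWith₂ a b) (block b ws)
takeB-block b [] = []
takeB-block b {(x ∷ []) ∷ ws} _ = []
takeB-block b {(x ∷ y ∷ w) ∷ ws} ((_ , refl) ∷ as) with y ≟a b
... | no _ = []
... | yes refl = (w , refl) ∷ takeB-block b as

takeB-ends : ∀ {k} (b : Letter k) ws → BlockEnds b (rest b ws)
takeB-ends b [] = tt
takeB-ends b ([] ∷ ws) = breaks-[]
takeB-ends b ((x ∷ []) ∷ ws) = breaks-[ x ]
takeB-ends b ((x ∷ y ∷ w) ∷ ws) with y ≟a b
... | no y≢b = breaks-≢ y≢b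
... | yes _ = takeB-ends b ws

takeB-rest : ∀ {k} {a : Letter k} b {ws} → All (StartsWith a) ws → All (StartsWith a) (rest b ws)
takeB-rest b {ws} as = ++⁻ʳ (block b ws) (subst (All _) (takeB-split b ws) as)

takeB-++ : ∀ {k} {a b : Letter k} {p R} → All (StartsWith₂ a b) p → BlockEnds b R → takeB b (p ++ R) ≡ (p , R)
takeB-++ {R = []} [] _ = refl
takeB-++ {R = [] ∷ R} [] _ = refl
takeB-++ {R = (x ∷ []) ∷ R} [] _ = refl
takeB-++ {b = b} {R = (x ∷ y ∷ w) ∷ R} [] (breaks-≢ y≢b) with y ≟a b
... | yes y≡b = ⊥-elim (y≢b y≡b)
... | no _ = refl
takeB-++ {b = b} ((v , refl) ∷ ps) ends with b ≟a b
... | no b≢b = ⊥-elim (b≢b refl)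
... | yes refl rewrite takeB-++ ps ends = refl

takeB-all : ∀ {k} {a b : Letter k} {p} → All (StartsWith₂ a b) p → takeB b p ≡ (p , [])
takeB-all {p = p} ps = subst (λ z → takeB _ z ≡ (p , [])) (++-identityʳ p) (takeB-++ ps tt)

labelOf : ∀ {Q : Set} {k} → Letter k → Label Q k
labelOf b = sy (proj₁ b) (proj₁ (proj₂ b))

-- the blockline ₁s'ⱼ of the paper, encoded by the left subtree of a node whose first word is a ∷ b ∷ w
leftChild : ∀ {k} → Letter k → Word k → List (Word k) → List (Word k)
leftChild b w ws = (b ∷ w) ∷ map tail (block b ws)

Enc : ∀ {Q : Set} {k} → Label Q k → List (Word k) → Tree (Label Q k)
Enc ρ L = enc (size L) ρ L

child : ∀ {Q : Set} {k} → Label Q k → List (Word k) → Maybe (Tree (Label Q k))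
child ρ [] = nothing
child ρ L@(_ ∷ _) = just (Enc ρ L)

size-++ : ∀ {k} (xs ys : Stack2 k) → size (xs ++ ys) ≡ size xs + size ys
size-++ xs ys rewrite map-++ length xs ys = sum-++ (map length xs) (map length ys)

size-map-tail : ∀ {k} (p : List (Word k)) → size (map tail p) ≤ size p
size-map-tail [] = z≤n
size-map-tail ([] ∷ p) = size-map-tail p
size-map-tail ((x ∷ w) ∷ p) = m≤n⇒m≤1+n (+-monoʳ-≤ (length w) (size-map-tail p))

size-leftChild : ∀ {k} (b : Letter k) w {ws} p {r} → ws ≡ p ++ r →
  size ((b ∷ w) ∷ map tail p) ≤ suc (length w) + size ws
size-leftChild b w p {r} refl rewrite size-++ p r =
  +-monoʳ-≤ (suc (length w)) (≤-trans (size-map-tail p) (m≤m+n (size p) (size r)))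

size-rest : ∀ {k} {ws r : List (Word k)} m p → ws ≡ p ++ r → size r ≤ m + size ws
size-rest {r = r} m p refl rewrite size-++ p r = ≤-trans (m≤n+m (size r) (size p)) (m≤n+m _ m)

enc-fuel : ∀ {Q : Set} {k} f f' (ρ : Label Q k) L → size L ≤ f → size L ≤ f' → enc f ρ L ≡ enc f' ρ L
enc-fuel zero zero ρ L _ _ = refl
enc-fuel zero (suc f') ρ [] _ _ = refl
enc-fuel zero (suc f') ρ ([] ∷ L) _ _ = refl
enc-fuel (suc f) zero ρ [] _ _ = refl
enc-fuel (suc f) zero ρ ([] ∷ L) _ _ = refl
enc-fuel (suc f) (suc f') ρ [] _ _ = refl
enc-fuel (suc f) (suc f') ρ ([] ∷ L) _ _ = refl
enc-fuel (suc f) (suc f') ρ ((a ∷ []) ∷ []) _ _ = refl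
enc-fuel (suc f) (suc f') ρ ((a ∷ []) ∷ w ∷ ws) (s≤s h) (s≤s h') =
  cong (λ t → node ρ nothing (just t)) (enc-fuel f f' eps (w ∷ ws) h h')
enc-fuel (suc f) (suc f') ρ ((a ∷ b ∷ w) ∷ ws) (s≤s h) (s≤s h') with takeB b ws | takeB-split b ws
... | p , [] | split = cong (λ t → node ρ (just t) nothing) (enc-fuel f f' _ _ (left h) (left h'))
  where
  left : ∀ {g} → suc (length w) + size ws ≤ g → size ((b ∷ w) ∷ map tail p) ≤ g
  left = ≤-trans (size-leftChild b w p split)
... | p , y ∷ r | split =
  cong₂ (λ t t' → node ρ (just t) (just t'))
    (enc-fuel f f' _ _ (left h) (left h')) (enc-fuel f f' eps (y ∷ r) (right h) (right h'))
  where
  left : ∀ {g} → suc (length w) + size ws ≤ g → size ((b ∷ w) ∷ map tail p) ≤ g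
  left = ≤-trans (size-leftChild b w p split)
  right : ∀ {g} → suc (length w) + size ws ≤ g → size (y ∷ r) ≤ g
  right = ≤-trans (size-rest (suc (length w)) p split)

enc-Enc : ∀ {Q : Set} {k} {f} (ρ : Label Q k) L → size L ≤ f → enc f ρ L ≡ Enc ρ L
enc-Enc ρ L h = enc-fuel _ _ ρ L h ≤-refl

Enc-[a] : ∀ {Q : Set} {k} {ρ : Label Q k} {a} ws → Enc ρ ((a ∷ []) ∷ ws) ≡ node ρ nothing (child eps ws)
Enc-[a] [] = refl
Enc-[a] (w ∷ ws) = refl

Enc-[ab] : ∀ {Q : Set} {k} {ρ : Label Q k} a b w ws →
  Enc ρ ((a ∷ b ∷ w) ∷ ws) ≡ node ρ (just (Enc (labelOf b) (leftChild b w ws))) (child eps (rest b ws))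
Enc-[ab] {Q} a b w ws with takeB b ws | takeB-split b ws
... | p , [] | split =
  cong (λ t → node _ (just t) nothing) (enc-Enc (labelOf {Q} b) ((b ∷ w) ∷ map tail p) (size-leftChild b w p split))
... | p , y ∷ r | split =
  cong₂ (λ t t' → node _ (just t) (just t'))
    (enc-Enc (labelOf {Q} b) ((b ∷ w) ∷ map tail p) (size-leftChild b w p split))
    (enc-Enc eps (y ∷ r) (size-rest (suc (length w)) p split))

Enc-root : ∀ {Q : Set} {k} {ρ : Label Q k} a w ws → lookupT (Enc ρ ((a ∷ w) ∷ ws)) [] ≡ just ρ
Enc-root a [] ws = cong (λ T → lookupT T []) (Enc-[a] ws)
Enc-root a (b ∷ w) ws = cong (λ T → lookupT T []) (Enc-[ab] a b w ws)

data IsNode {k} : Address → List (Word k) → Set where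
  root   : ∀ {w ws} → IsNode [] (w ∷ ws)
  left   : ∀ {d a b w ws} → IsNode d (leftChild b w ws) → IsNode (false ∷ d) ((a ∷ b ∷ w) ∷ ws)
  right₁ : ∀ {d a ws} → IsNode d ws → IsNode (true ∷ d) ((a ∷ []) ∷ ws)
  right₂ : ∀ {d a b w ws} → IsNode d (rest b ws) → IsNode (true ∷ d) ((a ∷ b ∷ w) ∷ ws)

IsNode-∷ : ∀ {k} {d} {L : List (Word k)} → IsNode d L → ∃ λ w → ∃ λ ws → L ≡ w ∷ ws
IsNode-∷ root = _ , _ , refl
IsNode-∷ (left _) = _ , _ , refl
IsNode-∷ (right₁ _) = _ , _ , refl
IsNode-∷ (right₂ _) = _ , _ , refl

-- the blockline encoded by the nodes lexicographically below d (junk value [] when d is no node)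
leftPart : ∀ {k} → Address → List (Word k) → List (Word k)
leftPart [] ((a ∷ _) ∷ _) = (a ∷ []) ∷ []
leftPart (false ∷ d) ((a ∷ b ∷ w) ∷ ws) = map (a ∷_) (leftPart d (leftChild b w ws))
leftPart (true ∷ d) ((a ∷ []) ∷ ws) = (a ∷ []) ∷ leftPart d ws
leftPart (true ∷ d) ((a ∷ b ∷ w) ∷ ws) = ((a ∷ b ∷ w) ∷ block b ws) ++ leftPart d (rest b ws)
leftPart _ _ = []

leftChild-startsWith : ∀ {k} {a : Letter k} b w {ws} → All (StartsWith a) ws → All (StartsWith b) (leftChild b w ws)
leftChild-startsWith b w as = (w , refl) ∷ map⁺ (All.map (λ { (v , refl) → v , refl }) (takeB-block b as))

map-∷-tail : ∀ {k} {a b : Letter k} {p} → All (StartsWith₂ a b) p → map (a ∷_) (map tail p) ≡ p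
map-∷-tail {p = p} ps = trans (sym (map-∘ p)) (map-id-local (All.map (λ { (v , refl) → refl }) ps))

map-∷-leftChild : ∀ {k} {a : Letter k} b w {ws} → All (StartsWith a) ws →
  map (a ∷_) (leftChild b w ws) ≡ (a ∷ b ∷ w) ∷ block b ws
map-∷-leftChild b w as = cong (_ ∷_) (map-∷-tail (takeB-block b as))

map-∷-leftChild-++ : ∀ {k} {a : Letter k} b w {ws} → All (StartsWith a) ws →
  map (a ∷_) (leftChild b w ws) ++ rest b ws ≡ (a ∷ b ∷ w) ∷ ws
map-∷-leftChild-++ b w {ws} as =
  trans (cong (_++ rest b ws) (map-∷-leftChild b w as)) (cong (_ ∷_) (sym (takeB-split b ws)))

leftPart-head : ∀ {k} {a : Letter k} {d L} → IsNode d L → All (StartsWith a) L →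
  ∃ λ v → ∃ λ R → leftPart d L ≡ (a ∷ v) ∷ R
leftPart-head root ((_ , refl) ∷ _) = [] , [] , refl
leftPart-head (left {b = b} {w} nd) ((_ , refl) ∷ as) with leftPart-head nd (leftChild-startsWith b w as)
... | v , R , eq rewrite eq = b ∷ v , map _ R , refl
leftPart-head (right₁ _) ((_ , refl) ∷ _) = [] , _ , refl
leftPart-head (right₂ _) ((_ , refl) ∷ _) = _ , _ , refl

leftPart-startsWith : ∀ {k} {a : Letter k} {d L} → IsNode d L → All (StartsWith a) L → All (StartsWith a) (leftPart d L)
leftPart-startsWith root ((_ , refl) ∷ _) = ([] , refl) ∷ []
leftPart-startsWith (left {b = b} {w} nd) ((_ , refl) ∷ as) =
  map⁺ (All.map (λ { (v , refl) → _ , refl }) (leftPart-startsWith nd (leftChild-startsWith b w as)))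
leftPart-startsWith (right₁ nd) ((_ , refl) ∷ as) = ([] , refl) ∷ leftPart-startsWith nd as
leftPart-startsWith (right₂ {b = b} nd) ((_ , refl) ∷ as) =
  (_ , refl) ∷ ++⁺ (All.map (λ { (v , refl) → _ , refl }) (takeB-block b as)) (leftPart-startsWith nd (takeB-rest b as))

leftPart-ends : ∀ {k} {a b : Letter k} {d L} → IsNode d L → All (StartsWith a) L →
  BlockEnds b L → BlockEnds b (leftPart d L)
leftPart-ends root ((_ , refl) ∷ _) _ = breaks-[ _ ]
leftPart-ends (left {b = b'} {w} nd) ((_ , refl) ∷ as) (breaks-≢ b'≢b) with leftPart-head nd (leftChild-startsWith b' w as)
... | v , R , eq rewrite eq = breaks-≢ b'≢b
leftPart-ends (right₁ _) ((_ , refl) ∷ _) _ = breaks-[ _ ]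
leftPart-ends (right₂ _) ((_ , refl) ∷ _) ends = ends

data Lex : Address → Address → Set where
  lex-[] : ∀ {d} → Lex [] d
  lex-∷  : ∀ {x d d'} → Lex d d' → Lex (x ∷ d) (x ∷ d')
  lex-01 : ∀ {d d'} → Lex (false ∷ d) (true ∷ d')

lex-∷⁻ : ∀ {x d d'} → Lex (x ∷ d) (x ∷ d') → Lex d d'
lex-∷⁻ (lex-∷ l) = l

Lex-refl : ∀ d → Lex d d
Lex-refl [] = lex-[]
Lex-refl (x ∷ d) = lex-∷ (Lex-refl d)

Lex-total : ∀ d d' → Lex d d' ⊎ Lex d' d
Lex-total [] d' = inj₁ lex-[]
Lex-total (x ∷ d) [] = inj₂ lex-[]
Lex-total (false ∷ d) (true ∷ d') = inj₁ lex-01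
Lex-total (true ∷ d) (false ∷ d') = inj₂ lex-01
Lex-total (false ∷ d) (false ∷ d') = Sum.map lex-∷ lex-∷ (Lex-total d d')
Lex-total (true ∷ d) (true ∷ d') = Sum.map lex-∷ lex-∷ (Lex-total d d')

≤lex⇒Lex : ∀ {d d'} → d ≤lex d' → Lex d d'
≤lex⇒Lex (inj₁ (e , d++e≡d')) = prefix _ d++e≡d'
  where
  prefix : ∀ d {d' e} → d ++ e ≡ d' → Lex d d'
  prefix [] _ = lex-[]
  prefix (x ∷ d) refl = lex-∷ (prefix d refl)
≤lex⇒Lex (inj₂ (u , v , v' , refl , refl)) = branch u
  where
  branch : ∀ u → Lex (u ++ false ∷ v) (u ++ true ∷ v')
  branch [] = lex-01
  branch (x ∷ u) = lex-∷ (branch u)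

Lex⇒≤lex : ∀ {d d'} → Lex d d' → d ≤lex d'
Lex⇒≤lex {d' = d'} lex-[] = inj₁ (d' , refl)
Lex⇒≤lex (lex-∷ {x} l) with Lex⇒≤lex l
... | inj₁ (e , eq) = inj₁ (e , cong (x ∷_) eq)
... | inj₂ (u , v , v' , eq , eq') = inj₂ (x ∷ u , v , v' , cong (x ∷_) eq , cong (x ∷_) eq')
Lex⇒≤lex (lex-01 {d} {d'}) = inj₂ ([] , d , d' , refl , refl)

RestrictsLex : ∀ {Γ : Set} → Tree Γ → Address → Tree Γ → Set
RestrictsLex T d T' = ∀ d' → (Lex d' d → lookupT T' d' ≡ lookupT T d') × (¬ Lex d' d → lookupT T' d' ≡ nothing)

restrictsLex⇒IsRestrictionLex : ∀ {Γ : Set} {T : Tree Γ} {d T'} → RestrictsLex T d T' → IsRestrictionLex T d T'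
restrictsLex⇒IsRestrictionLex rs d' =
  (λ le → proj₁ (rs d') (≤lex⇒Lex le)) , (λ ≰ → proj₂ (rs d') (λ l → ≰ (Lex⇒≤lex l)))

restricts-∷ : ∀ {Γ : Set} {T T' : Tree Γ} {d x} → RestrictsLex T d T' → ∀ d' →
  (Lex (x ∷ d') (x ∷ d) → lookupT T' d' ≡ lookupT T d') × (¬ Lex (x ∷ d') (x ∷ d) → lookupT T' d' ≡ nothing)
restricts-∷ rs d' = (λ l → proj₁ (rs d') (lex-∷⁻ l)) , (λ ≰ → proj₂ (rs d') (λ l → ≰ (lex-∷ l)))

restrict-root : ∀ {Γ : Set} (T : Tree Γ) {ρ} → lookupT T [] ≡ just ρ → RestrictsLex T [] (leaf ρ)
restrict-root T eq [] = (λ _ → sym eq) , (λ ≰ → ⊥-elim (≰ lex-[]))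
restrict-root T eq (false ∷ d') = (λ ()) , (λ _ → refl)
restrict-root T eq (true ∷ d') = (λ ()) , (λ _ → refl)

restrict-left : ∀ {Γ : Set} (ρ : Γ) {T T' right d} → RestrictsLex T d T' →
  RestrictsLex (node ρ (just T) right) (false ∷ d) (node ρ (just T') nothing)
restrict-left ρ _ [] = (λ _ → refl) , (λ ≰ → ⊥-elim (≰ lex-[]))
restrict-left ρ {T} {T'} rs (false ∷ d') = restricts-∷ {T = T} {T'} rs d'
restrict-left ρ _ (true ∷ d') = (λ ()) , (λ _ → refl)

restrict-right : ∀ {Γ : Set} (ρ : Γ) l {T T' d} → RestrictsLex T d T' →
  RestrictsLex (node ρ l (just T)) (true ∷ d) (node ρ l (just T'))
restrict-right ρ l _ [] = (λ _ → refl) , (λ ≰ → ⊥-elim (≰ lex-[]))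
restrict-right ρ nothing _ (false ∷ d') = (λ _ → refl) , (λ ≰ → ⊥-elim (≰ lex-01))
restrict-right ρ (just _) _ (false ∷ d') = (λ _ → refl) , (λ ≰ → ⊥-elim (≰ lex-01))
restrict-right ρ nothing {T} {T'} rs (true ∷ d') = restricts-∷ {T = T} {T'} rs d'
restrict-right ρ (just _) {T} {T'} rs (true ∷ d') = restricts-∷ {T = T} {T'} rs d'

child-node : ∀ {Q : Set} {k} {ρ : Label Q k} {d L} → IsNode d L → child ρ L ≡ just (Enc ρ L)
child-node root = refl
child-node (left _) = refl
child-node (right₁ _) = refl
child-node (right₂ _) = refl

∈dom-child : ∀ {Q : Set} {k} {ρ : Label Q k} l ρ' L {d} →
  (true ∷ d) ∈dom node ρ l (child ρ' L) → ∃ λ w → ∃ λ ws → L ≡ w ∷ ws × d ∈dom Enc ρ' (w ∷ ws)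
∈dom-child nothing ρ' (w ∷ ws) dom = w , ws , refl , dom
∈dom-child (just _) ρ' (w ∷ ws) dom = w , ws , refl , dom

∈dom⇒IsNode : ∀ {Q : Set} {k} {a : Letter k} (ρ : Label Q k) w ws {d} →
  All (StartsWith a) (w ∷ ws) → d ∈dom Enc ρ (w ∷ ws) → IsNode d (w ∷ ws)
∈dom⇒IsNode ρ w ws {[]} _ _ = root
∈dom⇒IsNode ρ [] ws {_ ∷ _} ((_ , ()) ∷ _) _
∈dom⇒IsNode ρ (a ∷ []) ws {false ∷ d} _ dom with subst ((false ∷ d) ∈dom_) (Enc-[a] ws) dom
... | _ , ()
∈dom⇒IsNode ρ (a ∷ []) ws {true ∷ d} (_ ∷ as) dom
  with ∈dom-child nothing eps ws (subst ((true ∷ d) ∈dom_) (Enc-[a] ws) dom)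
... | w' , ws' , refl , dom' = right₁ (∈dom⇒IsNode eps w' ws' as dom')
∈dom⇒IsNode {Q} ρ (a ∷ b ∷ w) ws {false ∷ d} ((_ , refl) ∷ as) dom =
  left (∈dom⇒IsNode (labelOf {Q} b) (b ∷ w) _ (leftChild-startsWith b w as)
    (subst ((false ∷ d) ∈dom_) (Enc-[ab] a b w ws) dom))
∈dom⇒IsNode {Q} ρ (a ∷ b ∷ w) ws {true ∷ d} ((_ , refl) ∷ as) dom
  with ∈dom-child (just (Enc (labelOf {Q} b) (leftChild b w ws))) eps (rest b ws)
                  (subst ((true ∷ d) ∈dom_) (Enc-[ab] a b w ws) dom)
... | w' , ws' , eq , dom' =
  right₂ (subst (IsNode d) (sym eq) (∈dom⇒IsNode eps w' ws' (subst (All _) eq (takeB-rest b as)) dom'))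

IsNode⇒∈dom : ∀ {Q : Set} {k} {a : Letter k} (ρ : Label Q k) {d L} → IsNode d L → All (StartsWith a) L →
  d ∈dom Enc ρ L
IsNode⇒∈dom ρ root ((w , refl) ∷ _) = ρ , Enc-root _ w _
IsNode⇒∈dom {Q} ρ (left {d} {a} {b} {w} {ws} nd) ((_ , refl) ∷ as) =
  subst ((false ∷ d) ∈dom_) (sym (Enc-[ab] a b w ws)) (IsNode⇒∈dom (labelOf {Q} b) nd (leftChild-startsWith b w as))
IsNode⇒∈dom {Q} ρ (right₁ nd) (_ ∷ as) with IsNode-∷ nd | IsNode⇒∈dom (eps {Q}) nd as
... | _ , _ , refl | dom = dom
IsNode⇒∈dom ρ (right₂ {d} {a} {b} {w} {ws} nd) ((_ , refl) ∷ as) =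
  subst ((true ∷ d) ∈dom_) (sym (trans (Enc-[ab] a b w ws) (cong (node ρ _) (child-node nd))))
    (IsNode⇒∈dom eps nd (takeB-rest b as))

Enc-map-∷ : ∀ {Q : Set} {k} (ρ : Label Q k) a b v R → All (StartsWith b) R →
  Enc ρ (map (a ∷_) ((b ∷ v) ∷ R)) ≡ node ρ (just (Enc (labelOf b) ((b ∷ v) ∷ R))) nothing
Enc-map-∷ ρ a b v R bs = trans (Enc-[ab] a b v (map (a ∷_) R)) split
  where
  starts₂ : All (StartsWith₂ a b) (map (a ∷_) R)
  starts₂ = map⁺ (All.map (λ { (u , refl) → u , refl }) bs)
  split : node ρ (just (Enc (labelOf b) (leftChild b v (map (a ∷_) R)))) (child eps (rest b (map (a ∷_) R)))
        ≡ node ρ (just (Enc (labelOf b) ((b ∷ v) ∷ R))) nothing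
  split rewrite takeB-all starts₂ | sym (map-∘ {g = tail} {f = a ∷_} R) | map-id R = refl

Enc-block-++ : ∀ {Q : Set} {k} (ρ : Label Q k) a b w {p y R} → All (StartsWith₂ a b) p → BlockEnds b (y ∷ R) →
  Enc ρ ((a ∷ b ∷ w) ∷ (p ++ y ∷ R))
    ≡ node ρ (just (Enc (labelOf b) ((b ∷ w) ∷ map tail p))) (just (Enc eps (y ∷ R)))
Enc-block-++ ρ a b w {p} {y} {R} ps ends = trans (Enc-[ab] a b w (p ++ y ∷ R)) split
  where
  split : node ρ (just (Enc (labelOf b) (leftChild b w (p ++ y ∷ R)))) (child eps (rest b (p ++ y ∷ R)))
        ≡ node ρ (just (Enc (labelOf b) ((b ∷ w) ∷ map tail p))) (just (Enc eps (y ∷ R)))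
  split rewrite takeB-++ {R = y ∷ R} ps ends = refl

Enc-leftPart : ∀ {Q : Set} {k} {a : Letter k} (ρ : Label Q k) {d L} → IsNode d L → All (StartsWith a) L →
  RestrictsLex (Enc ρ L) d (Enc ρ (leftPart d L))
Enc-leftPart {a = a} ρ (root {ws = ws}) ((w , refl) ∷ _) = restrict-root (Enc ρ ((a ∷ w) ∷ ws)) (Enc-root a w ws)
Enc-leftPart {Q} ρ (left {d} {a} {b} {w} {ws} nd) ((_ , refl) ∷ as)
  with leftPart d (leftChild b w ws) | leftPart-head nd (leftChild-startsWith b w as)
     | leftPart-startsWith nd (leftChild-startsWith b w as) | Enc-leftPart (labelOf {Q} b) nd (leftChild-startsWith b w as)
... | _ | v , R , refl | _ ∷ bs | restricts =
  subst₂ (λ T T' → RestrictsLex T (false ∷ d) T') (sym (Enc-[ab] a b w ws)) (sym (Enc-map-∷ ρ a b v R bs))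
    (restrict-left ρ restricts)
Enc-leftPart {Q} ρ (right₁ {d} {ws = ws} nd) (_ ∷ as)
  with IsNode-∷ nd | leftPart d ws | leftPart-head nd as | Enc-leftPart (eps {Q}) nd as
... | _ , _ , refl | _ | v , R , refl | restricts = restrict-right ρ nothing restricts
Enc-leftPart ρ (right₂ {d} {a} {b} {w} {ws} nd) ((_ , refl) ∷ as)
  with leftPart d (rest b ws) | leftPart-head nd (takeB-rest b as)
     | leftPart-ends nd (takeB-rest b as) (takeB-ends b ws) | Enc-leftPart eps nd (takeB-rest b as)
... | _ | v , Z , refl | ends | restricts =
  subst₂ (λ T T' → RestrictsLex T (true ∷ d) T')
    (sym (trans (Enc-[ab] a b w ws) (cong (node ρ _) (child-node nd))))
    (sym (Enc-block-++ ρ a b w (takeB-block b as) ends))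
    (restrict-right ρ (just _) restricts)

MilestoneAt : ∀ {k} → Stack2 k → ℕ → Stack2 k → Set
MilestoneAt L i t = ∃ λ u → i < length L × t ≡ take i L ++ u ∷ [] × u ≢ [] × (W L i ⊓ nth L i) ⊑ u × u ⊑ nth L i

Milestone : ∀ {k} → Stack2 k → Stack2 k → Set
Milestone L t = ∃ λ i → MilestoneAt L i t

milestone⇒prefixCut : ∀ {k} {L t : Stack2 k} → Milestone L t → PrefixCut L t
milestone⇒prefixCut (i , u , i<L , t≡ , u≢[] , _ , u⊑) = i , u , i<L , t≡ , u≢[] , u⊑

milestone⇒IsMilestone : ∀ {k} {s t : Stack2 k} → Milestone s t → IsMilestone s t
milestone⇒IsMilestone m@(i , u , i<s , t≡ , _ , meet⊑ , u⊑) =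
  prefixCut⇒≼ (milestone⇒prefixCut m) , i , i<s , u , t≡ , meet⊑ , u⊑

IsMilestone⇒milestone : ∀ {k} {s t : Stack2 k} → Stacks s → IsMilestone s t → Milestone s t
IsMilestone⇒milestone {s = s} hs (t≼s , i , i<s , u , refl , meet⊑ , u⊑) = i , u , i<s , refl , u≢[] , meet⊑ , u⊑
  where
  u≢[] : u ≢ []
  u≢[] with proj₂ (∷ʳ⁻ (proj₂ (stacks-wellFormed (stacks-≼ hs t≼s))))
  ... | _ , refl = λ ()

meet-⊑ : ∀ {k} {x : Word k} {a z u} → x ⊓ (a ∷ z) ≡ a ∷ [] → u ≢ [] → u ⊑ (a ∷ z) → (x ⊓ (a ∷ z)) ⊑ u
meet-⊑ meet≡ u≢[] u⊑ with ⊑∷-nonempty u⊑ u≢[]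
... | u' , refl rewrite meet≡ = u' , refl

⊓-breaks : ∀ {k} (a b : Letter k) v {z} → Breaks b (a ∷ z) → (a ∷ b ∷ v) ⊓ (a ∷ z) ≡ a ∷ []
⊓-breaks a b v {z} breaks rewrite ⊓-∷ a (b ∷ v) z = cong (a ∷_) (diverge breaks)
  where
  diverge : ∀ {z} → Breaks b (a ∷ z) → (b ∷ v) ⊓ z ≡ []
  diverge breaks-[ _ ] = refl
  diverge (breaks-≢ {y = y} y≢b) with b ≟a y
  ... | yes b≡y = ⊥-elim (y≢b (sym b≡y))
  ... | no _ = refl

W-++-length : ∀ {k} {a b : Letter k} B r → All (StartsWith₂ a b) B → B ≢ [] → StartsWith₂ a b (W (B ++ r) (length B))
W-++-length [] r _ B≢[] = ⊥-elim (B≢[] refl)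
W-++-length (x ∷ []) r (x₂ ∷ _) _ = x₂
W-++-length (x ∷ y ∷ B) r (_ ∷ ys) _ = W-++-length (y ∷ B) r ys (λ ())

meet-nonempty : ∀ {k} {b : Letter k} {x y u} → StartsWith b x → StartsWith b y → (x ⊓ y) ⊑ u → u ≢ []
meet-nonempty {b = b} (x , refl) (y , refl) meet⊑ rewrite ⊓-∷ b x y with ⊑-∷ʳ meet⊑
... | _ , refl , _ = λ ()

nth-map-++ : ∀ {k} (a : Letter k) L r {j} → j < length L → nth (map (a ∷_) L ++ r) j ≡ a ∷ nth L j
nth-map-++ a L r j<L = trans (nth-++ˡ (map (a ∷_) L) r (subst (_ <_) (sym (length-map (a ∷_) L)) j<L)) (nth-map (a ∷_) L j<L)

meet-map-++ : ∀ {k} (a : Letter k) L r {j} → suc j < length L →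
  (W (map (a ∷_) L ++ r) (suc j) ⊓ nth (map (a ∷_) L ++ r) (suc j)) ≡ a ∷ (W L (suc j) ⊓ nth L (suc j))
meet-map-++ a L r {j} j+1<L
  rewrite nth-map-++ a L r (<-trans (n<1+n j) j+1<L) | nth-map-++ a L r j+1<L = ⊓-∷ a (nth L j) (nth L (suc j))

take-map-++ : ∀ {k} (a : Letter k) (L r : List (Word k)) {i} → i ≤ length L →
  take i (map (a ∷_) L ++ r) ≡ map (a ∷_) (take i L)
take-map-++ a L r i≤L = trans (take-++ˡ (map (a ∷_) L) r (subst (_ ≤_) (sym (length-map _ L)) i≤L)) (take-map _ L)

milestoneAt-map : ∀ {k} (a : Letter k) {L} r {i R} → MilestoneAt L i R → MilestoneAt (map (a ∷_) L ++ r) i (map (a ∷_) R)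
milestoneAt-map a {L} r {i} (u , i<L , refl , _ , meet⊑ , u⊑) =
  a ∷ u , i<L++r , cut , (λ ()) , meet⊑′ i i<L meet⊑ , subst ((a ∷ u) ⊑_) (sym (nth-map-++ a L r i<L)) (∷-⊑ a u⊑)
  where
  i<L++r : i < length (map (a ∷_) L ++ r)
  i<L++r = begin-strict
    i                                  <⟨ i<L ⟩
    length L                           ≡⟨ length-map (a ∷_) L ⟨
    length (map (a ∷_) L)              ≤⟨ m≤m+n _ (length r) ⟩
    length (map (a ∷_) L) + length r   ≡⟨ length-++ (map (a ∷_) L) ⟨
    length (map (a ∷_) L ++ r)         ∎
    where open ≤-Reasoning
  cut : map (a ∷_) (take i L ++ u ∷ []) ≡ take i (map (a ∷_) L ++ r) ++ (a ∷ u) ∷ []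
  cut = trans (map-++ _ (take i L) (u ∷ [])) (cong (_++ (a ∷ u) ∷ []) (sym (take-map-++ a L r (<⇒≤ i<L))))
  meet⊑′ : ∀ i → i < length L → (W L i ⊓ nth L i) ⊑ u →
    (W (map (a ∷_) L ++ r) i ⊓ nth (map (a ∷_) L ++ r) i) ⊑ (a ∷ u)
  meet⊑′ zero _ _ = []⊑ _
  meet⊑′ (suc j) j+1<L meet⊑ rewrite meet-map-++ a L r j+1<L = ∷-⊑ a meet⊑

milestoneAt-map⁻ : ∀ {k} (a : Letter k) {b L} r {i t} → All (StartsWith b) L → i < length L →
  MilestoneAt (map (a ∷_) L ++ r) i t → t ≡ (a ∷ []) ∷ [] ⊎ ∃ λ R → MilestoneAt L i R × t ≡ map (a ∷_) R
milestoneAt-map⁻ a {L = L} r {zero} _ 0<L (u , _ , refl , u≢[] , _ , u⊑) rewrite nth-map-++ a L r 0<L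
  with ⊑∷-nonempty u⊑ u≢[]
... | [] , refl = inj₁ refl
... | c ∷ u' , refl = inj₂ ((c ∷ u') ∷ [] , (c ∷ u' , 0<L , refl , (λ ()) , []⊑ _ , ∷-⊑⁻ u⊑) , refl)
milestoneAt-map⁻ a {L = L} r {suc j} bs i<L (u , _ , refl , u≢[] , meet⊑ , u⊑)
  rewrite meet-map-++ a L r i<L | nth-map-++ a L r i<L with ⊑-∷ʳ meet⊑
... | u' , refl , meet⊑′ =
  inj₂ (take (suc j) L ++ u' ∷ [] ,
        (u' , i<L , refl , meet-nonempty (nth-All j bs (<-trans (n<1+n j) i<L)) (nth-All (suc j) bs i<L) meet⊑′ ,
         meet⊑′ , ∷-⊑⁻ u⊑) ,
        trans (cong (_++ (a ∷ u') ∷ []) (take-map-++ a L r (<⇒≤ i<L))) (sym (map-++ _ (take (suc j) L) (u' ∷ []))))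

milestoneAt-++ : ∀ {k} (B : Stack2 k) {r i R} → MilestoneAt r i R →
  (∀ {u} → u ≢ [] → u ⊑ nth r 0 → (W (B ++ r) (length B) ⊓ nth r 0) ⊑ u) →
  MilestoneAt (B ++ r) (length B + i) (B ++ R)
milestoneAt-++ B {r} {i} (u , i<r , refl , u≢[] , meet⊑ , u⊑) junction =
  u , B+i<B++r , cut , u≢[] , meet⊑′ i meet⊑ u⊑ , subst (u ⊑_) (sym (nth-++ʳ B r i)) u⊑
  where
  B+i<B++r : length B + i < length (B ++ r)
  B+i<B++r = subst (length B + i <_) (sym (length-++ B)) (+-monoʳ-< (length B) i<r)
  cut : B ++ (take i r ++ u ∷ []) ≡ take (length B + i) (B ++ r) ++ u ∷ []
  cut = trans (sym (++-assoc B (take i r) (u ∷ []))) (cong (_++ u ∷ []) (sym (take-++ʳ B r i)))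
  meet⊑′ : ∀ i → (W r i ⊓ nth r i) ⊑ u → u ⊑ nth r i →
    (W (B ++ r) (length B + i) ⊓ nth (B ++ r) (length B + i)) ⊑ u
  meet⊑′ zero _ u⊑ rewrite nth-++ʳ B r 0 | +-identityʳ (length B) = junction u≢[] u⊑
  meet⊑′ (suc j) meet⊑ _ rewrite nth-++ʳ B r (suc j) | +-suc (length B) j | nth-++ʳ B r j = meet⊑

milestoneAt-++⁻ : ∀ {k} (B : Stack2 k) {r i t} → MilestoneAt (B ++ r) (length B + i) t →
  ∃ λ R → MilestoneAt r i R × t ≡ B ++ R
milestoneAt-++⁻ B {r} {i} (u , lt , refl , u≢[] , meet⊑ , u⊑) =
  take i r ++ u ∷ [] ,
  (u , i<r , refl , u≢[] , meet⊑′ i meet⊑ , subst (u ⊑_) (nth-++ʳ B r i) u⊑) ,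
  trans (cong (_++ u ∷ []) (take-++ʳ B r i)) (++-assoc B (take i r) (u ∷ []))
  where
  i<r : i < length r
  i<r = +-cancelˡ-< (length B) i (length r) (subst (length B + i <_) (length-++ B) lt)
  meet⊑′ : ∀ i → (W (B ++ r) (length B + i) ⊓ nth (B ++ r) (length B + i)) ⊑ u → (W r i ⊓ nth r i) ⊑ u
  meet⊑′ zero _ = []⊑ u
  meet⊑′ (suc j) meet⊑ rewrite nth-++ʳ B r (suc j) | +-suc (length B) j | nth-++ʳ B r j = meet⊑

junction-block : ∀ {k} {a b : Letter k} (B : Stack2 k) {z r u} → All (StartsWith₂ a b) B → B ≢ [] → Breaks b (a ∷ z) →
  u ≢ [] → u ⊑ (a ∷ z) → (W (B ++ (a ∷ z) ∷ r) (length B) ⊓ (a ∷ z)) ⊑ u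
junction-block {a = a} {b} B {z} {r} bs B≢[] breaks u≢[] u⊑ with W-++-length B ((a ∷ z) ∷ r) bs B≢[]
... | v , eq rewrite eq = meet-⊑ (⊓-breaks a b v breaks) u≢[] u⊑

leftPart-milestone : ∀ {k} {a : Letter k} {d L} → IsNode d L → All (StartsWith a) L → Milestone L (leftPart d L)
leftPart-milestone root ((w , refl) ∷ _) = 0 , _ ∷ [] , s≤s z≤n , refl , (λ ()) , []⊑ _ , (w , refl)
leftPart-milestone (left {d} {a} {b} {w} {ws} nd) ((_ , refl) ∷ as) with leftPart-milestone nd (leftChild-startsWith b w as)
... | i , m = subst (λ X → Milestone X (map (a ∷_) (leftPart d (leftChild b w ws)))) (map-∷-leftChild-++ b w as)
  (i , milestoneAt-map a (rest b ws) m)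
leftPart-milestone (right₁ {a = a} nd) ((_ , refl) ∷ as) with IsNode-∷ nd | leftPart-milestone nd as
... | _ , _ , refl | i , m with as
...   | (z , refl) ∷ _ = suc i , milestoneAt-++ ((a ∷ []) ∷ []) m (meet-⊑ (⊓-∷ a [] z))
leftPart-milestone (right₂ {d} {a} {b} {w} {ws} nd) ((_ , refl) ∷ as)
  with rest b ws | takeB-split b ws | takeB-rest b as | takeB-ends b ws | IsNode-∷ nd | leftPart-milestone nd (takeB-rest b as)
... | _ | split | (z , refl) ∷ _ | breaks | _ , r , refl | i , m =
  subst (λ X → Milestone ((a ∷ b ∷ w) ∷ X) (B ++ leftPart d ((a ∷ z) ∷ r))) (sym split)
    (length B + i , milestoneAt-++ B m (junction-block B ((w , refl) ∷ takeB-block b as) (λ ()) breaks))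
  where B = (a ∷ b ∷ w) ∷ block b ws

leftPart-length : ∀ {k} {a : Letter k} {d L} → IsNode d L → All (StartsWith a) L → length (leftPart d L) ≤ length L
leftPart-length {L = L} nd as with leftPart-milestone nd as
... | i , u , i<L , eq , _ rewrite eq | length-++ (take i L) {u ∷ []} | length-take-≤ L (<⇒≤ i<L) | +-comm i 1 = i<L

leftPart≡root : ∀ {k} {a : Letter k} {d L} → IsNode d L → All (StartsWith a) L →
  leftPart d L ≡ (a ∷ []) ∷ [] → d ≡ []
leftPart≡root root _ _ = refl
leftPart≡root (left {d} {a} {b} {w} {ws} nd) ((_ , refl) ∷ as) eq
  with leftPart d (leftChild b w ws) | leftPart-head nd (leftChild-startsWith b w as)
... | _ | _ , _ , refl with eq
... | ()
leftPart≡root (right₁ {d} {ws = ws} nd) ((_ , refl) ∷ as) eq with leftPart d ws | leftPart-head nd as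
... | _ | _ , _ , refl with eq
... | ()
leftPart≡root (right₂ _) ((_ , refl) ∷ _) ()

≢-++-∷ : ∀ {A : Set} {X B : List A} {y Z} → length X ≤ length B → X ≢ B ++ y ∷ Z
≢-++-∷ {B = B} X≤B refl = m+1+n≰m (length B) (subst (_≤ length B) (length-++ B) X≤B)

-- the left parts of a left and of a right node differ already in length
leftPart-left≢right : ∀ {k} {a b : Letter k} {w ws d d'} → IsNode d (leftChild b w ws) → IsNode d' (rest b ws) →
  All (StartsWith a) ws → leftPart (false ∷ d) ((a ∷ b ∷ w) ∷ ws) ≢ leftPart (true ∷ d') ((a ∷ b ∷ w) ∷ ws)
leftPart-left≢right {a = a} {b} {w} {ws} {d} {d'} nd nd' as with leftPart d' (rest b ws) | leftPart-head nd' (takeB-rest b as)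
... | _ | _ , _ , refl = ≢-++-∷ (begin
  length (map (a ∷_) (leftPart d (leftChild b w ws))) ≡⟨ length-map _ (leftPart d (leftChild b w ws)) ⟩
  length (leftPart d (leftChild b w ws))              ≤⟨ leftPart-length nd (leftChild-startsWith b w as) ⟩
  length (leftChild b w ws)                           ≡⟨ cong suc (length-map tail (block b ws)) ⟩
  length ((a ∷ b ∷ w) ∷ block b ws)                   ∎)
  where open ≤-Reasoning

leftPart-injective : ∀ {k} {a : Letter k} {d d' L} → IsNode d L → IsNode d' L → All (StartsWith a) L →
  leftPart d L ≡ leftPart d' L → d ≡ d'
leftPart-injective root nd' as@((_ , refl) ∷ _) eq = sym (leftPart≡root nd' as (sym eq))
leftPart-injective nd root as@((_ , refl) ∷ _) eq = leftPart≡root nd as eq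
leftPart-injective (left {b = b} {w} nd) (left nd') ((_ , refl) ∷ as) eq =
  cong (false ∷_) (leftPart-injective nd nd' (leftChild-startsWith b w as) (map-injective ∷-injectiveʳ eq))
leftPart-injective (right₁ nd) (right₁ nd') (_ ∷ as) eq = cong (true ∷_) (leftPart-injective nd nd' as (∷-injectiveʳ eq))
leftPart-injective (right₂ {a = a} {b} {w} {ws} nd) (right₂ nd') ((_ , refl) ∷ as) eq =
  cong (true ∷_) (leftPart-injective nd nd' (takeB-rest b as) (++-cancelˡ ((a ∷ b ∷ w) ∷ block b ws) _ _ eq))
leftPart-injective (left nd) (right₂ nd') ((_ , refl) ∷ as) eq = ⊥-elim (leftPart-left≢right nd nd' as eq)
leftPart-injective (right₂ nd) (left nd') ((_ , refl) ∷ as) eq = ⊥-elim (leftPart-left≢right nd' nd as (sym eq))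

prefixCut-map : ∀ {k} (a : Letter k) {L t} → PrefixCut L t → PrefixCut (map (a ∷_) L) (map (a ∷_) t)
prefixCut-map a {L} (i , u , i<L , refl , _ , u⊑) =
  i , a ∷ u , subst (i <_) (sym (length-map _ L)) i<L ,
  trans (map-++ _ (take i L) (u ∷ [])) (cong (_++ (a ∷ u) ∷ []) (sym (take-map i L))) ,
  (λ ()) , subst ((a ∷ u) ⊑_) (sym (nth-map (a ∷_) L i<L)) (∷-⊑ a u⊑)

prefixCut-++ : ∀ {k} (B : Stack2 k) {L t} → PrefixCut L t → PrefixCut (B ++ L) (B ++ t)
prefixCut-++ [] cut = cut
prefixCut-++ (x ∷ B) cut with prefixCut-++ B cut
... | i , u , i<L , eq , u≢[] , u⊑ = suc i , u , s≤s i<L , cong (x ∷_) eq , u≢[] , u⊑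

prefixCut-++ʳ : ∀ {k} {L t : Stack2 k} R → PrefixCut L t → PrefixCut (L ++ R) t
prefixCut-++ʳ {L = L} R (i , u , i<L , refl , u≢[] , u⊑) =
  i , u , ≤-trans i<L (subst (length L ≤_) (sym (length-++ L)) (m≤m+n _ _)) ,
  cong (_++ u ∷ []) (sym (take-++ˡ L R (<⇒≤ i<L))) , u≢[] , subst (u ⊑_) (sym (nth-++ˡ L R i<L)) u⊑

leftPart-mono : ∀ {k} {a : Letter k} {d d' L} → IsNode d L → IsNode d' L → All (StartsWith a) L →
  Lex d d' → PrefixCut (leftPart d' L) (leftPart d L)
leftPart-mono {d' = d'} {L} root nd' as@((_ , refl) ∷ _) lex-[] with leftPart d' L | leftPart-head nd' as
... | _ | v , _ , refl = 0 , _ , s≤s z≤n , refl , (λ ()) , (v , refl)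
leftPart-mono (left {a = a} {b} {w} nd) (left nd') ((_ , refl) ∷ as) (lex-∷ d≤d') =
  prefixCut-map a (leftPart-mono nd nd' (leftChild-startsWith b w as) d≤d')
leftPart-mono (right₁ {a = a} nd) (right₁ nd') (_ ∷ as) (lex-∷ d≤d') =
  prefixCut-++ ((a ∷ []) ∷ []) (leftPart-mono nd nd' as d≤d')
leftPart-mono (right₂ {a = a} {b} {w} {ws} nd) (right₂ nd') ((_ , refl) ∷ as) (lex-∷ d≤d') =
  prefixCut-++ ((a ∷ b ∷ w) ∷ block b ws) (leftPart-mono nd nd' (takeB-rest b as) d≤d')
leftPart-mono (left {d} {a} {b} {w} {ws} nd) (right₂ {d'} nd') ((_ , refl) ∷ as) lex-01 =
  prefixCut-++ʳ (leftPart d' (rest b ws))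
    (subst (λ X → PrefixCut X (map (a ∷_) (leftPart d (leftChild b w ws)))) (map-∷-leftChild b w as)
      (prefixCut-map a (milestone⇒prefixCut (leftPart-milestone nd (leftChild-startsWith b w as)))))

leftPart-surjective : ∀ {k} n {a : Letter k} {L t} → size L ≤ n → All (StartsWith a) L → Milestone L t →
  ∃ λ d → IsNode d L × leftPart d L ≡ t
leftPart-surjective n {L = []} _ _ (_ , _ , () , _)
leftPart-surjective n {L = [] ∷ _} _ ((_ , ()) ∷ _) _
leftPart-surjective zero {L = (_ ∷ _) ∷ _} () _ _
leftPart-surjective (suc n) {L = (a ∷ []) ∷ ws} _ _ (zero , u , _ , refl , u≢[] , _ , u⊑) with ⊑∷-nonempty u⊑ u≢[]
... | [] , refl = [] , root , refl
... | _ ∷ _ , refl with u⊑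
... | _ , ()
leftPart-surjective (suc n) {L = (a ∷ []) ∷ ws} (s≤s L≤n) (_ ∷ as) (suc i , m)
  with milestoneAt-++⁻ ((a ∷ []) ∷ []) m
... | R , m' , refl with leftPart-surjective n L≤n as (i , m')
... | d , nd , refl = true ∷ d , right₁ nd , refl
leftPart-surjective (suc n) {L = (a ∷ b ∷ w) ∷ ws} {t} (s≤s L≤n) ((_ , refl) ∷ as) (i , m)
  with subst (λ X → MilestoneAt X i t) (sym (map-∷-leftChild-++ b w as)) m | i <? length (leftChild b w ws)
... | m′ | yes i<LC with milestoneAt-map⁻ a (rest b ws) (leftChild-startsWith b w as) i<LC m′
...   | inj₁ refl = [] , root , refl
...   | inj₂ (R , m″ , refl)
  with leftPart-surjective n (≤-trans (size-leftChild b w (block b ws) (takeB-split b ws)) L≤n)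
         (leftChild-startsWith b w as) (i , m″)
...     | d , nd , refl = false ∷ d , left nd , refl
leftPart-surjective (suc n) {L = (a ∷ b ∷ w) ∷ ws} {t} (s≤s L≤n) ((_ , refl) ∷ as) (i , m)
    | m′ | no i≮LC with m≤n⇒∃[o]m+o≡n (≮⇒≥ i≮LC)
...   | i' , refl
  with milestoneAt-++⁻ (map (a ∷_) (leftChild b w ws))
         (subst (λ j → MilestoneAt (map (a ∷_) (leftChild b w ws) ++ rest b ws) (j + i') t)
                (sym (length-map _ (leftChild b w ws))) m′)
...   | R , m″ , refl
  with leftPart-surjective n (≤-trans (size-rest (suc (length w)) (block b ws) (takeB-split b ws)) L≤n)
         (takeB-rest b as) (i' , m″)
...   | d , nd , refl = true ∷ d , right₂ nd , cong (_++ leftPart d (rest b ws)) (sym (map-∷-leftChild b w as))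

wellFormed-∈dom⇒IsNode : ∀ {Q : Set} {k} {ρ : Label Q k} {s d} → WellFormed s → d ∈dom Enc ρ s → IsNode d s
wellFormed-∈dom⇒IsNode {s = []} (s≢[] , _) _ = ⊥-elim (s≢[] refl)
wellFormed-∈dom⇒IsNode {s = w ∷ ws} (_ , as) dom = ∈dom⇒IsNode _ w ws as dom

module LeftStack {k m : ℕ} (q : Fin m) {s : Stack2 k} (hs : Stacks s) where

  private
    as : All (StartsWith bottomLetter) s
    as = proj₂ (stacks-wellFormed hs)

  -- apart from the root, Encode(q,s) consists of its left subtree Encode(s)
  node-address : ∀ {d} → d ∈dom EncodeConf q s → d ≢ [] → ∃ λ d' → d ≡ false ∷ d' × IsNode d' s
  node-address {[]} _ d≢[] = ⊥-elim (d≢[] refl)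
  node-address {true ∷ d} (_ , ()) _
  node-address {false ∷ d} dom _ = d , refl , wellFormed-∈dom⇒IsNode (stacks-wellFormed hs) dom

  nodeOf : Dom q s → Address
  nodeOf (_ , dom , d≢[]) = proj₁ (node-address dom d≢[])

  nodeOf-address : ∀ (x : Dom q s) → proj₁ x ≡ false ∷ nodeOf x
  nodeOf-address (_ , dom , d≢[]) = proj₁ (proj₂ (node-address dom d≢[]))

  nodeOf-isNode : ∀ (x : Dom q s) → IsNode (nodeOf x) s
  nodeOf-isNode (_ , dom , d≢[]) = proj₂ (proj₂ (node-address dom d≢[]))

  leftStack : Dom q s → Stack2 k
  leftStack x = leftPart (nodeOf x) s

  leftStack-isLeftStack : ∀ (x : Dom q s) → IsLeftStack q s (proj₁ x) (leftStack x)
  leftStack-isLeftStack x = subst (λ d → IsLeftStack q s d (leftStack x)) (sym (nodeOf-address x)) (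
    stacks-≼ hs (prefixCut⇒≼ (milestone⇒prefixCut (leftPart-milestone nd as))) ,
    restrictsLex⇒IsRestrictionLex {T = EncodeConf q s} {T' = EncodeConf q (leftStack x)}
      (restrict-left (st q) (Enc-leftPart (sy ⊥s one) nd as)))
    where nd = nodeOf-isNode x

  leftStack-milestone : ∀ (x : Dom q s) → IsMilestone s (leftStack x)
  leftStack-milestone x = milestone⇒IsMilestone (leftPart-milestone (nodeOf-isNode x) as)

  leftStack-injective : ∀ (x y : Dom q s) → leftStack x ≡ leftStack y → proj₁ x ≡ proj₁ y
  leftStack-injective x y eq = begin
    proj₁ x          ≡⟨ nodeOf-address x ⟩
    false ∷ nodeOf x ≡⟨ cong (false ∷_) (leftPart-injective (nodeOf-isNode x) (nodeOf-isNode y) as eq) ⟩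
    false ∷ nodeOf y ≡⟨ nodeOf-address y ⟨
    proj₁ y          ∎
    where open ≡-Reasoning

  leftStack-surjective : ∀ t → IsMilestone s t → ∃ λ x → leftStack x ≡ t
  leftStack-surjective t ml with leftPart-surjective (size s) ≤-refl as (IsMilestone⇒milestone hs ml)
  ... | d , nd , eq = (false ∷ d , IsNode⇒∈dom (sy ⊥s one) nd as , λ ()) , eq

  leftStack-order : ∀ (x y : Dom q s) → (proj₁ x ≤lex proj₁ y) ⇔ (leftStack x ≼ leftStack y)
  leftStack-order x y = subst₂ (λ d d' → (d ≤lex d') ⇔ (leftStack x ≼ leftStack y))
    (sym (nodeOf-address x)) (sym (nodeOf-address y)) (mk⇔ monotone reflecting)
    where
    nd = nodeOf-isNode x
    nd' = nodeOf-isNode y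
    monotone : (false ∷ nodeOf x) ≤lex (false ∷ nodeOf y) → leftStack x ≼ leftStack y
    monotone d≤d' = prefixCut⇒≼ (leftPart-mono nd nd' as (lex-∷⁻ (≤lex⇒Lex d≤d')))
    reflecting : leftStack x ≼ leftStack y → (false ∷ nodeOf x) ≤lex (false ∷ nodeOf y)
    reflecting x≼y with Lex-total (nodeOf x) (nodeOf y)
    ... | inj₁ d≤d' = Lex⇒≤lex (lex-∷ d≤d')
    ... | inj₂ d'≤d with leftPart-injective nd nd' as (≼-antisym x≼y (prefixCut⇒≼ (leftPart-mono nd' nd as d'≤d)))
    ... | eq rewrite eq = Lex⇒≤lex (Lex-refl _)

mainTheorem5 : ∀ {k m : ℕ} (q : Fin m) (s : Stack2 k) → Stacks s →
    Σ (Dom q s → Stack2 k) λ g →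
      (∀ x → IsLeftStack q s (proj₁ x) (g x)) × IsOrderIsoMilestones q s g
mainTheorem5 q s hs =
  leftStack , leftStack-isLeftStack , leftStack-milestone , leftStack-injective , leftStack-surjective , leftStack-order
  where open LeftStack q hs
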